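{- The set $B'=\biguplus_{k=0}^{\lfloor n/2\rfloor}\{G_T : T\in SYT_{(n-k,k)}\}$ is contained in $H=I^\perp$ and is linearly independent.
   Context: Let $K$ be a field of characteristic $0$, $R=K[y_1,\dots,y_n]$ and $I=\langle y_1+\cdots+y_n, y_1^2,\dots,y_n^2\rangle$. For $P,Q\in R$ define the scalar product $\langle P,Q\rangle = \big(P(\tfrac{\partial}{\partial y_1},\dots,\tfrac{\partial}{\partial y_n})Q\big)(0,\dots,0)$, and let $H=I^\perp$ be the orthogonal complement of $I$; equivalently $H=\{Q\in R : P(\tfrac{\partial}{\partial y_1},\dots,\tfrac{\partial}{\partial y_n})Q=0 \text{ for all generators } P \text{ of } I\}$, and $H\cong R/I$. For a partition $\lambda=(n-k,k)$, a standard Young tableau $T\in SYT_\lambda$ is a filling of the two-row diagram of shape $\lambda$ with $1,\dots,n$ bijectively, increasing along rows and up columns; write $T(1,j)$ and $T(2,j)$ for the entries in column $j$ in the first (length $n-k$) and second (length $k$) row. Define $G_T = (y_{T(1,1)}-y_{T(2,1)})(y_{T(1,2)}-y_{T(2,2)})\cdots(y_{T(1,k)}-y_{T(2,k)})$. -}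

module Defs where

open import Level using (Level; _⊔_) renaming (suc to lsuc)
open import Algebra.Bundles using (CommutativeRing)
open import Data.Nat as ℕ using (ℕ; zero; suc)
open import Data.Nat.DivMod using (_/_)
open import Data.Fin as Fin using (Fin)
open import Data.Vec as Vec using (Vec; lookup; replicate; _[_]≔_; zipWith; toList)
open import Data.Vec.Properties using (≡-dec)
open import Data.List as List using (List; []; _∷_; _++_; map; concatMap; foldr; zip; allFin)
open import Data.List.Relation.Unary.All using (All)
open import Data.List.Relation.Unary.Unique.Propositional using (Unique)
open import Data.Product using (Σ; ∃; _×_; _,_; proj₁; proj₂)
open import Data.Sum using (_⊎_)
open import Data.Bool using (if_then_else_)
open import Relation.Nullary using (¬_; does)
open import Relation.Binary.PropositionalEquality using (_≡_; _≢_)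

record Field (c ℓ : Level) : Set (lsuc (c ⊔ ℓ)) where
  field
    commutativeRing : CommutativeRing c ℓ
  open CommutativeRing commutativeRing public
  field
    1≉0     : ¬ (1# ≈ 0#)
    inverse : ∀ x → ¬ (x ≈ 0#) → Σ Carrier λ y → (x * y) ≈ 1#

module WithField {c ℓ : Level} (F : Field c ℓ) where
  open Field F

  fromℕ : ℕ → Carrier
  fromℕ zero    = 0#
  fromℕ (suc m) = 1# + fromℕ m

  CharZero : Set ℓ
  CharZero = ∀ m → ¬ (fromℕ (suc m) ≈ 0#)

  -- Polynomials in K[y_1..y_n]: finite lists of terms (coefficient, exponent vector);
  -- equality is equality of all coefficients.
  Poly : ℕ → Set c
  Poly n = List (Carrier × Vec ℕ n)

  coeff : ∀ {n} → Poly n → Vec ℕ n → Carrier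
  coeff []             m = 0#
  coeff ((a , e) ∷ p) m = if does (≡-dec ℕ._≟_ e m) then a + coeff p m else coeff p m

  infix 4 _≈P_
  _≈P_ : ∀ {n} → Poly n → Poly n → Set ℓ
  p ≈P q = ∀ m → coeff p m ≈ coeff q m

  0P : ∀ {n} → Poly n
  0P = []

  _+P_ : ∀ {n} → Poly n → Poly n → Poly n
  p +P q = p ++ q

  scaleP : ∀ {n} → Carrier → Poly n → Poly n
  scaleP a p = map (λ t → (a * proj₁ t , proj₂ t)) p

  negP : ∀ {n} → Poly n → Poly n
  negP p = scaleP (- 1#) p

  _-P_ : ∀ {n} → Poly n → Poly n → Poly n
  p -P q = p +P negP q

  _*P_ : ∀ {n} → Poly n → Poly n → Poly n
  p *P q = concatMap (λ s → map (λ t → (proj₁ s * proj₁ t , zipWith ℕ._+_ (proj₂ s) (proj₂ t))) q) p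

  1P : ∀ {n} → Poly n
  1P {n} = (1# , replicate n 0) ∷ []

  var : ∀ {n} → Fin n → Poly n
  var {n} i = (1# , (replicate n 0 [ i ]≔ 1)) ∷ []

  sumP : ∀ {n} → List (Poly n) → Poly n
  sumP = foldr _+P_ 0P

  prodP : ∀ {n} → List (Poly n) → Poly n
  prodP = foldr _*P_ 1P

  dTerm : ∀ {n} → Fin n → Carrier × Vec ℕ n → Poly n
  dTerm i (a , e) with lookup e i
  ... | zero  = []
  ... | suc k = (a * fromℕ (suc k) , (e [ i ]≔ k)) ∷ []

  ∂ : ∀ {n} → Fin n → Poly n → Poly n
  ∂ i p = concatMap (dTerm i) p

  iter : ∀ {A : Set c} → ℕ → (A → A) → A → A
  iter zero    f x = x
  iter (suc k) f x = f (iter k f x)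

  ∂^ : ∀ {n} → Vec ℕ n → Poly n → Poly n
  ∂^ {n} e q = foldr (λ i r → iter (lookup e i) (∂ i) r) q (allFin n)

  applyOp : ∀ {n} → Poly n → Poly n → Poly n
  applyOp P Q = concatMap (λ t → scaleP (proj₁ t) (∂^ (proj₂ t) Q)) P

  ⟨_,_⟩ : ∀ {n} → Poly n → Poly n → Carrier
  ⟨_,_⟩ {n} P Q = coeff (applyOp P Q) (replicate n 0)

  gen : ∀ {n} → Fin (suc n) → Poly n
  gen {n} Fin.zero    = sumP (map var (allFin n))
  gen     (Fin.suc i) = var i *P var i

  InI : ∀ {n} → Poly n → Set (c ⊔ ℓ)
  InI {n} P = Σ (Fin (suc n) → Poly n) λ A → P ≈P sumP (map (λ j → A j *P gen j) (allFin (suc n)))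

  InH : ∀ {n} → Poly n → Set (c ⊔ ℓ)
  InH Q = ∀ P → InI P → ⟨ P , Q ⟩ ≈ 0#

-- Standard Young tableaux of shape (n-k, k), entries 1..n encoded as Fin n.
-- row1 = first row (length n-k), row2 = second row (length k); column j is
-- (row1[j], row2[j]) for j < k.
record SYT (n k : ℕ) : Set where
  field
    row1 : Vec (Fin n) (n ℕ.∸ k)
    row2 : Vec (Fin n) k
    row1-incr : ∀ i j → i Fin.< j → lookup row1 i Fin.< lookup row1 j
    row2-incr : ∀ i j → i Fin.< j → lookup row2 i Fin.< lookup row2 j
    col-incr  : All (λ ab → proj₁ ab Fin.< proj₂ ab) (zip (toList row1) (toList row2))
    covers    : ∀ x → (∃ λ j → lookup row1 j ≡ x) ⊎ (∃ λ j → lookup row2 j ≡ x)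
    disjoint  : ∀ i j → lookup row1 i ≢ lookup row2 j

Idx : ℕ → Set
Idx n = Σ ℕ λ k → (k ℕ.≤ n / 2) × SYT n k

key : ∀ {n} → Idx n → Σ ℕ λ k → Vec (Fin n) (n ℕ.∸ k) × Vec (Fin n) k
key (k , _ , T) = k , SYT.row1 T , SYT.row2 T

module WithField₂ {c ℓ : Level} (F : Field c ℓ) where
  open Field F
  open WithField F

  G : ∀ {n} → Idx n → Poly n
  G (k , _ , T) = prodP (map (λ ab → var (proj₁ ab) -P var (proj₂ ab))
                            (zip (toList (SYT.row1 T)) (toList (SYT.row2 T))))

  lincomb : ∀ {n} → List (Carrier × Idx n) → Poly n
  lincomb xs = sumP (map (λ ct → scaleP (proj₁ ct) (G (proj₂ ct))) xs)

  LinIndepB' : ℕ → Set (c ⊔ ℓ)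
  LinIndepB' n = ∀ (xs : List (Carrier × Idx n)) →
    Unique (map (λ ct → key (proj₂ ct)) xs) →
    lincomb xs ≈P 0P →
    All (λ ct → proj₁ ct ≈ 0#) xs

-- G_T is a product of k factors y_a − y_b over pairwise disjoint pairs, so it is
-- squarefree.  On a squarefree Q the pairing ⟨P , Q⟩ is just ∑ₑ pₑ qₑ, and a polynomial pairs to
-- zero with all of I as soon as it pairs to zero with every monomial multiple of each generator.
-- For y_i² this holds because Q is squarefree; for y_1 + ⋯ + y_n it says that the derivation
-- ∑ᵢ ∂ᵢ kills Q, which it does on each factor y_a − y_b.  For independence, weigh a monomial by
-- ∑ᵢ i · eᵢ: the heaviest monomial of G_T is the product of its second-row variables, with
-- coefficient ±1, and it determines T; so the family is unitriangular.
module Submission where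

open import Defs
open import Data.Nat using (ℕ)
open import Data.Product using (_×_)

open import Level using (Level)
open import Data.Nat as ℕ using (_≤_; _<_; z≤n; s≤s)
import Data.Nat.Properties as ℕP
open import Data.Fin as Fin using (Fin; toℕ)
import Data.Fin.Properties as FinP
open import Data.Vec as Vec using (Vec; []; _∷_; lookup; replicate; _[_]≔_; zipWith; toList)
open import Data.Vec.Properties as VecP using (≡-dec)
open import Data.List as List using (List; []; _∷_; _++_; map; foldr; zip; allFin; length)
import Data.List.Properties as ListP
open import Data.List.Relation.Unary.All as All using (All; []; _∷_)
import Data.List.Relation.Unary.All.Properties as AllP
open import Data.List.Relation.Unary.AllPairs using (AllPairs; []; _∷_)
open import Data.List.Relation.Unary.Any using (here; there)
open import Data.List.Relation.Unary.Unique.Propositional using (Unique)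
open import Data.List.Relation.Unary.Unique.Propositional.Properties using (allFin⁺)
open import Data.List.Relation.Unary.Unique.DecPropositional.Properties using (deduplicate-!)
open import Data.List.Membership.Propositional using (_∈_; _∉_)
open import Data.List.Membership.Propositional.Properties using (∈-allFin; ∈-map⁺; ∈-++⁺ˡ; ∈-++⁺ʳ; ∈-deduplicate⁺)
open import Data.Product using (∃; ∃₂; _,_; proj₁; proj₂)
open import Data.Sum using (inj₁; inj₂)
open import Data.Unit using (⊤; tt)
open import Data.Empty using (⊥-elim)
open import Function using (_∘_)
open import Function.Definitions using (Injective)
open import Relation.Nullary using (¬_; yes; no)
open import Relation.Binary.Definitions using (tri<; tri≈; tri>)
open import Relation.Binary.PropositionalEquality
  using (_≡_; _≢_; refl; sym; trans; cong; cong₂; subst; ≢-sym; module ≡-Reasoning)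
import Algebra.Properties.CommutativeSemigroup as CommutativeSemigroupProperties
import Algebra.Properties.Ring as RingProperties

length-middle : ∀ {a} {A : Set a} (xs : List A) y zs → length (xs ++ y ∷ zs) ≡ ℕ.suc (length (xs ++ zs))
length-middle xs y zs =
  trans (ListP.length-++ xs) (trans (ℕP.+-suc (length xs) (length zs)) (cong ℕ.suc (sym (ListP.length-++ xs))))

All-middle : ∀ {a p} {A : Set a} {P : A → Set p} (xs : List A) {y zs} → P y → All P (xs ++ zs) → All P (xs ++ y ∷ zs)
All-middle xs Py Pxs++zs = AllP.++⁺ (AllP.++⁻ˡ xs Pxs++zs) (Py ∷ AllP.++⁻ʳ xs Pxs++zs)

Unique-middle : ∀ {a b} {A : Set a} {B : Set b} (g : A → B) xs y zs → Unique (map g (xs ++ y ∷ zs)) →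
                All (λ x → g x ≢ g y) (xs ++ zs) × Unique (map g (xs ++ zs))
Unique-middle g []       y zs (y∉zs ∷ uniq) = All.map ≢-sym (AllP.map⁻ y∉zs) , uniq
Unique-middle g (x ∷ xs) y zs (x∉ ∷ uniq) with Unique-middle g xs y zs uniq | AllP.++⁻ xs (AllP.map⁻ x∉)
... | ≢y , uniq′ | x∉xs , (x≢y ∷ x∉zs) = (x≢y ∷ ≢y) , AllP.map⁺ (AllP.++⁺ x∉xs x∉zs) ∷ uniq′

module Exponents where
  open import Data.Nat using (_+_; suc)
  private module +-CS = CommutativeSemigroupProperties ℕP.+-commutativeSemigroup

  infixl 6 _⊕_
  _⊕_ : ∀ {n} → Vec ℕ n → Vec ℕ n → Vec ℕ n
  _⊕_ = zipWith _+_

  basis : ∀ {n} → Fin n → Vec ℕ n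
  basis {n} i = replicate n 0 [ i ]≔ 1

  pointwise⇒≡ : ∀ {a} {A : Set a} {n} {v w : Vec A n} → (∀ i → lookup v i ≡ lookup w i) → v ≡ w
  pointwise⇒≡ {v = v} {w} v≗w =
    trans (sym (VecP.tabulate∘lookup v)) (trans (VecP.tabulate-cong v≗w) (VecP.tabulate∘lookup w))

  lookup-⊕ : ∀ {n} (x y : Vec ℕ n) i → lookup (x ⊕ y) i ≡ lookup x i + lookup y i
  lookup-⊕ x y i = VecP.lookup-zipWith _+_ i x y

  lookup-basis : ∀ {n} (i : Fin n) → lookup (basis i) i ≡ 1
  lookup-basis {n} i = VecP.lookup∘update i (replicate n 0) 1

  lookup-basis-≢ : ∀ {n} {i j : Fin n} → i ≢ j → lookup (basis i) j ≡ 0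
  lookup-basis-≢ {n} {i} {j} i≢j =
    trans (VecP.lookup∘update′ (≢-sym i≢j) (replicate n 0) 1) (VecP.lookup-replicate j 0)

  lookup-basis-⊕ : ∀ {n} (i : Fin n) m → lookup (basis i ⊕ m) i ≡ suc (lookup m i)
  lookup-basis-⊕ i m = trans (lookup-⊕ (basis i) m i) (cong (_+ lookup m i) (lookup-basis i))

  ⊕-assoc : ∀ {n} (x y z : Vec ℕ n) → (x ⊕ y) ⊕ z ≡ x ⊕ (y ⊕ z)
  ⊕-assoc = VecP.zipWith-assoc ℕP.+-assoc

  ⊕-comm : ∀ {n} (x y : Vec ℕ n) → x ⊕ y ≡ y ⊕ x
  ⊕-comm = VecP.zipWith-comm ℕP.+-comm

  ⊕-cancelˡ : ∀ {n} (x : Vec ℕ n) {y z} → x ⊕ y ≡ x ⊕ z → y ≡ z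
  ⊕-cancelˡ x {y} {z} eq = pointwise⇒≡ λ i → ℕP.+-cancelˡ-≡ (lookup x i) _ _
    (trans (sym (lookup-⊕ x y i)) (trans (cong (λ v → lookup v i) eq) (lookup-⊕ x z i)))

  basis-⊕-split : ∀ {n} (e : Vec ℕ n) x {k} → lookup e x ≡ suc k → e ≡ basis x ⊕ (e [ x ]≔ k)
  basis-⊕-split e x {k} eₓ≡1+k = pointwise⇒≡ λ j → sym (trans (lookup-⊕ (basis x) _ j) (lookup-split j))
    where
    lookup-split : ∀ j → lookup (basis x) j + lookup (e [ x ]≔ k) j ≡ lookup e j
    lookup-split j with x Fin.≟ j
    ... | yes refl rewrite lookup-basis x | VecP.lookup∘update x e k = sym eₓ≡1+k
    ... | no x≢j rewrite lookup-basis-≢ x≢j = VecP.lookup∘update′ (≢-sym x≢j) e k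

  update-basis-⊕ : ∀ {n} (m : Vec ℕ n) i k →
                   (basis i ⊕ m) [ i ]≔ (lookup (basis i ⊕ m) i + k) ≡ m [ i ]≔ (lookup m i + suc k)
  update-basis-⊕ m i k = pointwise⇒≡ lookup-≡
    where
    lookup-≡ : ∀ j → lookup ((basis i ⊕ m) [ i ]≔ (lookup (basis i ⊕ m) i + k)) j
                   ≡ lookup (m [ i ]≔ (lookup m i + suc k)) j
    lookup-≡ j with i Fin.≟ j
    ... | yes refl rewrite VecP.lookup∘update i (basis i ⊕ m) (lookup (basis i ⊕ m) i + k)
                         | VecP.lookup∘update i m (lookup m i + suc k)
                         | lookup-basis-⊕ i m = sym (ℕP.+-suc (lookup m i) k)
    ... | no i≢j rewrite VecP.lookup∘update′ (≢-sym i≢j) (basis i ⊕ m) (lookup (basis i ⊕ m) i + k)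
                       | VecP.lookup∘update′ (≢-sym i≢j) m (lookup m i + suc k)
                       | lookup-⊕ (basis i) m j | lookup-basis-≢ i≢j = refl

  -- weight e = ∑ᵢ i · eᵢ
  weight : ∀ {n} → Vec ℕ n → ℕ
  weight []      = 0
  weight (x ∷ v) = Vec.sum v + weight v

  sum-basis-⊕ : ∀ {n} (a : Fin n) e → Vec.sum (basis a ⊕ e) ≡ suc (Vec.sum e)
  sum-basis-⊕ Fin.zero    (x ∷ e) = cong (λ v → suc x + Vec.sum v) (VecP.zipWith-identityˡ ℕP.+-identityˡ e)
  sum-basis-⊕ (Fin.suc a) (x ∷ e) = trans (cong (x +_) (sum-basis-⊕ a e)) (ℕP.+-suc x _)

  weight-basis-⊕ : ∀ {n} (a : Fin n) e → weight (basis a ⊕ e) ≡ toℕ a + weight e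
  weight-basis-⊕ Fin.zero    (x ∷ e) = cong (λ v → Vec.sum v + weight v) (VecP.zipWith-identityˡ ℕP.+-identityˡ e)
  weight-basis-⊕ (Fin.suc a) (x ∷ e) rewrite sum-basis-⊕ a e | weight-basis-⊕ a e =
    cong suc (+-CS.x∙yz≈y∙xz (Vec.sum e) (toℕ a) (weight e))

  infix 4 _⊑_
  _⊑_ : ∀ {n} → Vec ℕ n → Vec ℕ n → Set
  e ⊑ E = weight e ≤ weight E × (weight e ≡ weight E → e ≡ E)

  weight-basis-⊕-< : ∀ {n} {a b : Fin n} {e E} → a Fin.< b → weight e ≤ weight E →
                     weight (basis a ⊕ e) < weight (basis b ⊕ E)
  weight-basis-⊕-< {a = a} {b} {e} {E} a<b e≤E
    rewrite weight-basis-⊕ a e | weight-basis-⊕ b E = ℕP.+-mono-<-≤ a<b e≤E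

  ⊑-basis-⊕-< : ∀ {n} {a b : Fin n} {e E} → a Fin.< b → e ⊑ E → basis a ⊕ e ⊑ basis b ⊕ E
  ⊑-basis-⊕-< a<b (e≤E , _) =
    ℕP.<⇒≤ (weight-basis-⊕-< a<b e≤E) , λ eq → ⊥-elim (ℕP.<⇒≢ (weight-basis-⊕-< a<b e≤E) eq)

  ⊑-basis-⊕ : ∀ {n} (b : Fin n) {e E} → e ⊑ E → basis b ⊕ e ⊑ basis b ⊕ E
  ⊑-basis-⊕ b {e} {E} (e≤E , e≡E) rewrite weight-basis-⊕ b e | weight-basis-⊕ b E =
    ℕP.+-monoʳ-≤ (toℕ b) e≤E , λ eq → cong (basis b ⊕_) (e≡E (ℕP.+-cancelˡ-≡ (toℕ b) _ _ eq))

  Squarefree : ∀ {n} → Vec ℕ n → Set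
  Squarefree e = ∀ j → lookup e j ≤ 1

  -- A pair (a , b) stands for the linear factor y_a − y_b.
  Absent : ∀ {n} → Fin n → List (Fin n × Fin n) → Set
  Absent j zs = All (λ ab → j ≢ proj₁ ab × j ≢ proj₂ ab) zs

  PairwiseDisjoint : ∀ {n} → List (Fin n × Fin n) → Set
  PairwiseDisjoint []             = ⊤
  PairwiseDisjoint ((a , b) ∷ zs) = Absent a zs × Absent b zs × PairwiseDisjoint zs

  SupportedIn : ∀ {n} → List (Fin n × Fin n) → Vec ℕ n → Set
  SupportedIn zs e = ∀ j → Absent j zs → lookup e j ≡ 0

  Squarefree-basis-⊕ : ∀ {n} {x : Fin n} {e} → lookup e x ≡ 0 → Squarefree e → Squarefree (basis x ⊕ e)
  Squarefree-basis-⊕ {x = x} {e} eₓ≡0 sq j with x Fin.≟ j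
  ... | yes refl rewrite lookup-basis-⊕ x e | eₓ≡0 = s≤s z≤n
  ... | no x≢j rewrite lookup-⊕ (basis x) e j | lookup-basis-≢ x≢j = sq j

  SupportedIn-basis-⊕ : ∀ {n} {x : Fin n} {ab zs e} → (∀ {j} → Absent j (ab ∷ zs) → j ≢ x) →
                        SupportedIn zs e → SupportedIn (ab ∷ zs) (basis x ⊕ e)
  SupportedIn-basis-⊕ {x = x} {e = e} j∉⇒j≢x supp j j∉
    rewrite lookup-⊕ (basis x) e j | lookup-basis-≢ (≢-sym (j∉⇒j≢x j∉)) = supp j (All.tail j∉)

  ¬Squarefree-⊕-basis² : ∀ {n} (e : Vec ℕ n) i → ¬ Squarefree (e ⊕ (basis i ⊕ basis i))
  ¬Squarefree-⊕-basis² e i sq with sq i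
  ... | eᵢ+2≤1 rewrite lookup-⊕ e (basis i ⊕ basis i) i | lookup-basis-⊕ i (basis i) | lookup-basis i =
    ℕP.<⇒≱ (ℕP.m≤n+m 2 (lookup e i)) eᵢ+2≤1

  ⊕-basis-≢-0 : ∀ {n} (e : Vec ℕ n) i → e ⊕ basis i ≢ replicate n 0
  ⊕-basis-≢-0 e i eq = ℕP.0≢1+n (begin
    0                               ≡⟨ VecP.lookup-replicate i 0 ⟨
    lookup (replicate _ 0) i        ≡⟨ cong (λ v → lookup v i) eq ⟨
    lookup (e ⊕ basis i) i          ≡⟨ lookup-⊕ e (basis i) i ⟩
    lookup e i + lookup (basis i) i ≡⟨ cong (lookup e i +_) (lookup-basis i) ⟩
    lookup e i + 1                  ≡⟨ ℕP.+-comm (lookup e i) 1 ⟩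
    suc (lookup e i)                ∎)
    where open ≡-Reasoning

  basis-⊕-≢-⊕-basis : ∀ {n} {x i : Fin n} (f e : Vec ℕ n) → lookup e x ≡ 0 → i ≢ x → basis x ⊕ f ≢ e ⊕ basis i
  basis-⊕-≢-⊕-basis {x = x} {i} f e eₓ≡0 i≢x eq = ℕP.0≢1+n (begin
    0                               ≡⟨ cong₂ _+_ eₓ≡0 (lookup-basis-≢ i≢x) ⟨
    lookup e x + lookup (basis i) x ≡⟨ lookup-⊕ e (basis i) x ⟨
    lookup (e ⊕ basis i) x          ≡⟨ cong (λ v → lookup v x) eq ⟨
    lookup (basis x ⊕ f) x          ≡⟨ lookup-basis-⊕ x f ⟩
    suc (lookup f x)                ∎)
    where open ≡-Reasoning

  Increasing : ∀ {n} → List (Fin n × Fin n) → Set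
  Increasing = All (λ ab → proj₁ ab Fin.< proj₂ ab)

  leadExp : ∀ {n} → List (Fin n × Fin n) → Vec ℕ n
  leadExp = foldr (λ ab e → basis (proj₂ ab) ⊕ e) (replicate _ 0)

  leadExp-support⁺ : ∀ {n} (zs : List (Fin n × Fin n)) {i} → i ∈ map proj₂ zs → 1 ≤ lookup (leadExp zs) i
  leadExp-support⁺ ((a , b) ∷ zs) {i} (here refl) rewrite lookup-basis-⊕ i (leadExp zs) = s≤s z≤n
  leadExp-support⁺ ((a , b) ∷ zs) {i} (there i∈zs) rewrite lookup-⊕ (basis b) (leadExp zs) i =
    ℕP.≤-trans (leadExp-support⁺ zs i∈zs) (ℕP.m≤n+m _ _)

  leadExp-support⁻ : ∀ {n} (zs : List (Fin n × Fin n)) {i} → 1 ≤ lookup (leadExp zs) i → i ∈ map proj₂ zs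
  leadExp-support⁻ []             {i} 1≤ with subst (1 ≤_) (VecP.lookup-replicate i 0) 1≤
  ... | ()
  leadExp-support⁻ ((a , b) ∷ zs) {i} 1≤ with b Fin.≟ i
  ... | yes refl = here refl
  ... | no b≢i rewrite lookup-⊕ (basis b) (leadExp zs) i | lookup-basis-≢ b≢i =
    there (leadExp-support⁻ zs 1≤)

open Exponents

module Tableaux where
  open import Data.Nat using (_+_; _*_; _∸_)
  open import Data.Nat.DivMod using (_/_; m/n*n≤m)
  open import Data.Vec.Relation.Unary.Any using (index)
  open import Data.Vec.Relation.Unary.Any.Properties using (lookup-index)
  open import Data.Vec.Membership.Propositional.Properties using (∈-lookup; ∈-toList⁺; ∈-toList⁻)

  lookup∈toList : ∀ {a} {A : Set a} {p} (v : Vec A p) j → lookup v j ∈ toList v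
  lookup∈toList v j = ∈-toList⁺ (∈-lookup j v)

  ∈toList⇒lookup : ∀ {a} {A : Set a} {p} (v : Vec A p) {z} → z ∈ toList v → ∃ λ j → lookup v j ≡ z
  ∈toList⇒lookup v z∈v = index (∈-toList⁻ z∈v) , sym (lookup-index (∈-toList⁻ z∈v))

  toList-≡⇒length-≡ : ∀ {a} {A : Set a} {p q} (v : Vec A p) (w : Vec A q) → toList v ≡ toList w → p ≡ q
  toList-≡⇒length-≡ v w eq = trans (sym (VecP.length-toList v)) (trans (cong length eq) (VecP.length-toList w))

  toList-injective : ∀ {a} {A : Set a} {p} (v w : Vec A p) → toList v ≡ toList w → v ≡ w
  toList-injective v w eq = trans (sym (VecP.cast-is-id refl v)) (VecP.toList-injective refl v w eq)

  StrictlyIncreasing : ∀ {n p} → Vec (Fin n) p → Set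
  StrictlyIncreasing v = ∀ i j → i Fin.< j → lookup v i Fin.< lookup v j

  increasing⇒AllPairs : ∀ {n p} (v : Vec (Fin n) p) → StrictlyIncreasing v → AllPairs Fin._<_ (toList v)
  increasing⇒AllPairs []      _   = []
  increasing⇒AllPairs (x ∷ v) inc = All.tabulate head-least ∷ increasing⇒AllPairs v (λ i j i<j → inc _ _ (s≤s i<j))
    where
    head-least : ∀ {y} → y ∈ toList v → x Fin.< y
    head-least y∈v with ∈toList⇒lookup v y∈v
    ... | j , refl = inc Fin.zero (Fin.suc j) (s≤s z≤n)

  increasing⇒injective : ∀ {n p} (v : Vec (Fin n) p) → StrictlyIncreasing v → Injective _≡_ _≡_ (lookup v)
  increasing⇒injective v inc {i} {j} vᵢ≡vⱼ with FinP.<-cmp i j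
  ... | tri< i<j _ _ = ⊥-elim (FinP.<-irrefl vᵢ≡vⱼ (inc i j i<j))
  ... | tri≈ _ i≡j _ = i≡j
  ... | tri> _ _ j<i = ⊥-elim (FinP.<-irrefl (sym vᵢ≡vⱼ) (inc j i j<i))

  AllPairs<-≡ : ∀ {n} {xs ys : List (Fin n)} → AllPairs Fin._<_ xs → AllPairs Fin._<_ ys →
                (∀ {z} → z ∈ xs → z ∈ ys) → (∀ {z} → z ∈ ys → z ∈ xs) → xs ≡ ys
  AllPairs<-≡ {xs = []}     {[]}     _ _ _ _ = refl
  AllPairs<-≡ {xs = []}     {y ∷ ys} _ _ _ ys⊆xs with ys⊆xs (here refl)
  ... | ()
  AllPairs<-≡ {xs = x ∷ xs} {[]}     _ _ xs⊆ys _ with xs⊆ys (here refl)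
  ... | ()
  AllPairs<-≡ {xs = x ∷ xs} {y ∷ ys} (x<xs ∷ <xs) (y<ys ∷ <ys) xs⊆ys ys⊆xs =
    cong₂ _∷_ x≡y (AllPairs<-≡ <xs <ys tail⊆ tail⊇)
    where
    x≡y : x ≡ y
    x≡y with xs⊆ys (here refl) | ys⊆xs (here refl)
    ... | here x≡y   | _          = x≡y
    ... | there _    | here y≡x   = sym y≡x
    ... | there x∈ys | there y∈xs = ⊥-elim (ℕP.<-asym (All.lookup y<ys x∈ys) (All.lookup x<xs y∈xs))
    tail⊆ : ∀ {z} → z ∈ xs → z ∈ ys
    tail⊆ z∈xs with xs⊆ys (there z∈xs)
    ... | here refl  = ⊥-elim (FinP.<-irrefl x≡y (All.lookup x<xs z∈xs))
    ... | there z∈ys = z∈ys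
    tail⊇ : ∀ {z} → z ∈ ys → z ∈ xs
    tail⊇ z∈ys with ys⊆xs (there z∈ys)
    ... | here refl  = ⊥-elim (FinP.<-irrefl (sym x≡y) (All.lookup y<ys z∈ys))
    ... | there z∈xs = z∈xs

  map-proj₂-zip : ∀ {A B : Set} {p q} (v : Vec A p) (w : Vec B q) → q ≤ p →
                  map proj₂ (zip (toList v) (toList w)) ≡ toList w
  map-proj₂-zip []      []      _         = refl
  map-proj₂-zip (x ∷ v) []      _         = refl
  map-proj₂-zip (x ∷ v) (y ∷ w) (s≤s q≤p) = cong (y ∷_) (map-proj₂-zip v w q≤p)

  Absent-zip : ∀ {n p q} z (v : Vec (Fin n) p) (w : Vec (Fin n) q) →
               (∀ i → z ≢ lookup v i) → (∀ j → z ≢ lookup w j) → Absent z (zip (toList v) (toList w))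
  Absent-zip z []      []      _   _   = []
  Absent-zip z []      (y ∷ w) _   _   = []
  Absent-zip z (x ∷ v) []      _   _   = []
  Absent-zip z (x ∷ v) (y ∷ w) z∉v z∉w =
    (z∉v Fin.zero , z∉w Fin.zero) ∷ Absent-zip z v w (z∉v ∘ Fin.suc) (z∉w ∘ Fin.suc)

  PairwiseDisjoint-zip : ∀ {n p q} (v : Vec (Fin n) p) (w : Vec (Fin n) q) →
    Injective _≡_ _≡_ (lookup v) → Injective _≡_ _≡_ (lookup w) → (∀ i j → lookup v i ≢ lookup w j) →
    PairwiseDisjoint (zip (toList v) (toList w))
  PairwiseDisjoint-zip []      []      _     _     _        = tt
  PairwiseDisjoint-zip []      (y ∷ w) _     _     _        = tt
  PairwiseDisjoint-zip (x ∷ v) []      _     _     _        = tt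
  PairwiseDisjoint-zip (x ∷ v) (y ∷ w) inj-v inj-w v∩w≡∅ =
    Absent-zip x v w (λ i eq → 0≢suc (inj-v eq)) (λ j → v∩w≡∅ Fin.zero (Fin.suc j)) ,
    Absent-zip y v w (λ i eq → v∩w≡∅ (Fin.suc i) Fin.zero (sym eq)) (λ j eq → 0≢suc (inj-w eq)) ,
    PairwiseDisjoint-zip v w (FinP.suc-injective ∘ inj-v) (FinP.suc-injective ∘ inj-w)
      (λ i j → v∩w≡∅ (Fin.suc i) (Fin.suc j))
    where
    0≢suc : ∀ {m} {i : Fin m} → Fin.zero ≢ Fin.suc i
    0≢suc ()

  k≤n∸k : ∀ n k → k ≤ n / 2 → k ≤ n ∸ k
  k≤n∸k n k k≤n/2 = ℕP.m+n≤o⇒m≤o∸n k (begin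
    k + k     ≡⟨ cong (k +_) (sym (ℕP.+-identityʳ k)) ⟩
    2 * k     ≡⟨ ℕP.*-comm 2 k ⟩
    k * 2     ≤⟨ ℕP.*-monoˡ-≤ 2 k≤n/2 ⟩
    n / 2 * 2 ≤⟨ m/n*n≤m n 2 ⟩
    n         ∎)
    where open ℕP.≤-Reasoning

  firstRow secondRow : ∀ {n} → Idx n → List (Fin n)
  firstRow  (_ , _ , T) = toList (SYT.row1 T)
  secondRow (_ , _ , T) = toList (SYT.row2 T)

  columns : ∀ {n} → Idx n → List (Fin n × Fin n)
  columns t = zip (firstRow t) (secondRow t)

  columns-increasing : ∀ {n} (t : Idx n) → Increasing (columns t)
  columns-increasing (_ , _ , T) = SYT.col-incr T

  columns-disjoint : ∀ {n} (t : Idx n) → PairwiseDisjoint (columns t)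
  columns-disjoint (_ , _ , T) = PairwiseDisjoint-zip (SYT.row1 T) (SYT.row2 T)
    (increasing⇒injective (SYT.row1 T) (SYT.row1-incr T))
    (increasing⇒injective (SYT.row2 T) (SYT.row2-incr T)) (SYT.disjoint T)

  secondRow-columns : ∀ {n} (t : Idx n) → map proj₂ (columns t) ≡ secondRow t
  secondRow-columns {n} (k , k≤n/2 , T) = map-proj₂-zip (SYT.row1 T) (SYT.row2 T) (k≤n∸k n k k≤n/2)

  firstRow-⊆ : ∀ {n} (t t′ : Idx n) → (∀ {z} → z ∈ secondRow t′ → z ∈ secondRow t) →
               ∀ {z} → z ∈ firstRow t → z ∈ firstRow t′
  firstRow-⊆ (_ , _ , T) (_ , _ , T′) row₂′⊆row₂ {z} z∈row₁ with SYT.covers T′ z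
  ... | inj₁ (j , refl) = lookup∈toList (SYT.row1 T′) j
  ... | inj₂ (j , refl) with ∈toList⇒lookup (SYT.row1 T) z∈row₁
                           | ∈toList⇒lookup (SYT.row2 T) (row₂′⊆row₂ (lookup∈toList (SYT.row2 T′) j))
  ...   | i , eq₁ | i′ , eq₂ = ⊥-elim (SYT.disjoint T i i′ (trans eq₁ (sym eq₂)))

  key-≡ : ∀ {n} (t t′ : Idx n) → firstRow t ≡ firstRow t′ → secondRow t ≡ secondRow t′ → key t ≡ key t′
  key-≡ (k , _ , T) (_ , _ , T′) row₁≡ row₂≡ with toList-≡⇒length-≡ (SYT.row2 T) (SYT.row2 T′) row₂≡
  ... | refl = cong₂ (λ r₁ r₂ → k , r₁ , r₂) (toList-injective (SYT.row1 T) (SYT.row1 T′) row₁≡)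
                                             (toList-injective (SYT.row2 T) (SYT.row2 T′) row₂≡)

  key-from-secondRow : ∀ {n} (t t′ : Idx n) → (∀ {z} → z ∈ secondRow t → z ∈ secondRow t′) →
                       (∀ {z} → z ∈ secondRow t′ → z ∈ secondRow t) → key t ≡ key t′
  key-from-secondRow t@(_ , _ , T) t′@(_ , _ , T′) row₂⊆ row₂⊇ = key-≡ t t′
    (AllPairs<-≡ (increasing⇒AllPairs _ (SYT.row1-incr T)) (increasing⇒AllPairs _ (SYT.row1-incr T′))
                 (firstRow-⊆ t t′ row₂⊇) (firstRow-⊆ t′ t row₂⊆))
    (AllPairs<-≡ (increasing⇒AllPairs _ (SYT.row2-incr T)) (increasing⇒AllPairs _ (SYT.row2-incr T′)) row₂⊆ row₂⊇)

  leadExp-determines-key : ∀ {n} (t t′ : Idx n) → leadExp (columns t) ≡ leadExp (columns t′) → key t ≡ key t′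
  leadExp-determines-key t t′ eq = key-from-secondRow t t′ (transfer t t′ eq) (transfer t′ t (sym eq))
    where
    transfer : ∀ s s′ → leadExp (columns s) ≡ leadExp (columns s′) → ∀ {z} → z ∈ secondRow s → z ∈ secondRow s′
    transfer s s′ eq′ {z} z∈s =
      subst (z ∈_) (secondRow-columns s′) (leadExp-support⁻ (columns s′)
        (subst (λ e → 1 ≤ lookup e z) eq′
          (leadExp-support⁺ (columns s) (subst (z ∈_) (sym (secondRow-columns s)) z∈s))))

open Tableaux

module _ {c ℓ : Level} (F : Field c ℓ) where
  open Field F renaming (refl to ≈-refl; sym to ≈-sym; trans to ≈-trans)
  open WithField F
  open WithField₂ F
  open import Relation.Binary.Reasoning.Setoid setoid
  module *-CS = CommutativeSemigroupProperties *-commutativeSemigroup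
  module +-CS = CommutativeSemigroupProperties +-commutativeSemigroup

  +-≈0ʳ : ∀ {x y} → y ≈ 0# → x + y ≈ x
  +-≈0ʳ {x} y≈0 = ≈-trans (+-cong ≈-refl y≈0) (+-identityʳ x)

  +-≈0ˡ : ∀ {x y} → x ≈ 0# → x + y ≈ y
  +-≈0ˡ {y = y} x≈0 = ≈-trans (+-cong x≈0 ≈-refl) (+-identityˡ y)

  *-≈0ʳ : ∀ {x y} → y ≈ 0# → x * y ≈ 0#
  *-≈0ʳ {x} y≈0 = ≈-trans (*-cong ≈-refl y≈0) (zeroʳ x)

  *-≈0ˡ : ∀ {x y} → x ≈ 0# → x * y ≈ 0#
  *-≈0ˡ {y = y} x≈0 = ≈-trans (*-cong x≈0 ≈-refl) (zeroˡ y)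

  x*y≈0∧y≉0⇒x≈0 : ∀ {x y} → x * y ≈ 0# → ¬ (y ≈ 0#) → x ≈ 0#
  x*y≈0∧y≉0⇒x≈0 {x} {y} xy≈0 y≉0 with inverse y y≉0
  ... | y⁻¹ , yy⁻¹≈1 = begin
    x              ≈⟨ *-identityʳ x ⟨
    x * 1#         ≈⟨ *-cong ≈-refl yy⁻¹≈1 ⟨
    x * (y * y⁻¹)  ≈⟨ *-assoc x y y⁻¹ ⟨
    (x * y) * y⁻¹  ≈⟨ *-≈0ˡ xy≈0 ⟩
    0#             ∎

  x*x≈1⇒x≉0 : ∀ {x} → x * x ≈ 1# → ¬ (x ≈ 0#)
  x*x≈1⇒x≉0 xx≈1 x≈0 = 1≉0 (≈-trans (≈-sym xx≈1) (*-≈0ˡ x≈0))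

  -- Finite sums

  ∑ : ∀ {a} {A : Set a} → List A → (A → Carrier) → Carrier
  ∑ []       g = 0#
  ∑ (x ∷ xs) g = g x + ∑ xs g

  syntax ∑ xs (λ x → e) = ∑[ x ← xs ] e

  ∑-cong : ∀ {a} {A : Set a} (xs : List A) {g h : A → Carrier} → (∀ {x} → x ∈ xs → g x ≈ h x) → ∑ xs g ≈ ∑ xs h
  ∑-cong []       _   = ≈-refl
  ∑-cong (x ∷ xs) g≈h = +-cong (g≈h (here refl)) (∑-cong xs (g≈h ∘ there))

  ∑-≈0 : ∀ {a} {A : Set a} (xs : List A) {g : A → Carrier} → (∀ {x} → x ∈ xs → g x ≈ 0#) → ∑ xs g ≈ 0#
  ∑-≈0 []       _    = ≈-refl
  ∑-≈0 (x ∷ xs) g≈0 = ≈-trans (+-≈0ʳ (∑-≈0 xs (g≈0 ∘ there))) (g≈0 (here refl))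

  ∑-++ : ∀ {a} {A : Set a} (xs ys : List A) (g : A → Carrier) → ∑ (xs ++ ys) g ≈ ∑ xs g + ∑ ys g
  ∑-++ []       ys g = ≈-sym (+-identityˡ _)
  ∑-++ (x ∷ xs) ys g = ≈-trans (+-cong ≈-refl (∑-++ xs ys g)) (≈-sym (+-assoc _ _ _))

  ∑-distrib-+ : ∀ {a} {A : Set a} (xs : List A) (g h : A → Carrier) → ∑[ x ← xs ] (g x + h x) ≈ ∑ xs g + ∑ xs h
  ∑-distrib-+ []       g h = ≈-sym (+-identityˡ 0#)
  ∑-distrib-+ (x ∷ xs) g h = ≈-trans (+-cong ≈-refl (∑-distrib-+ xs g h)) (+-CS.interchange _ _ _ _)

  *-distribˡ-∑ : ∀ {a} {A : Set a} (xs : List A) (k : Carrier) (g : A → Carrier) → k * ∑ xs g ≈ ∑[ x ← xs ] (k * g x)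
  *-distribˡ-∑ []       k g = zeroʳ k
  *-distribˡ-∑ (x ∷ xs) k g = ≈-trans (distribˡ k _ _) (+-cong ≈-refl (*-distribˡ-∑ xs k g))

  ∑-single : ∀ {a} {A : Set a} (xs : List A) {g : A → Carrier} {z} → Unique xs → z ∈ xs →
             (∀ x → x ≢ z → g x ≈ 0#) → ∑ xs g ≈ g z
  ∑-single (x ∷ xs) (x∉xs ∷ _) (here refl) g≈0 =
    +-≈0ʳ (∑-≈0 xs (λ y∈xs → g≈0 _ (λ { refl → All.lookup x∉xs y∈xs refl })))
  ∑-single (x ∷ xs) (x∉xs ∷ uniq) (there z∈xs) g≈0 =
    ≈-trans (+-≈0ˡ (g≈0 x (λ { refl → All.lookup x∉xs z∈xs refl }))) (∑-single xs uniq z∈xs g≈0)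

  ∑-middle : ∀ {a} {A : Set a} (xs : List A) y zs (g : A → Carrier) → ∑ (xs ++ y ∷ zs) g ≈ g y + ∑ (xs ++ zs) g
  ∑-middle xs y zs g = begin
    ∑ (xs ++ y ∷ zs) g              ≈⟨ ∑-++ xs (y ∷ zs) g ⟩
    ∑ xs g + (g y + ∑ zs g)         ≈⟨ +-CS.x∙yz≈y∙xz _ _ _ ⟩
    g y + (∑ xs g + ∑ zs g)         ≈⟨ +-cong ≈-refl (∑-++ xs zs g) ⟨
    g y + ∑ (xs ++ zs) g            ∎

  coeff-++ : ∀ {n} (p q : Poly n) m → coeff (p ++ q) m ≈ coeff p m + coeff q m
  coeff-++ []            q m = ≈-sym (+-identityˡ _)
  coeff-++ ((a , e) ∷ p) q m with ≡-dec ℕ._≟_ e m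
  ... | yes _ = ≈-trans (+-cong ≈-refl (coeff-++ p q m)) (≈-sym (+-assoc _ _ _))
  ... | no _  = coeff-++ p q m

  coeff-outside : ∀ {n} {P : Vec ℕ n → Set} (p : Poly n) {m} → All (P ∘ proj₂) p → ¬ P m → coeff p m ≈ 0#
  coeff-outside []            []         _   = ≈-refl
  coeff-outside ((a , e) ∷ p) {m} (Pe ∷ Pp) ¬Pm with ≡-dec ℕ._≟_ e m
  ... | yes refl = ⊥-elim (¬Pm Pe)
  ... | no _     = coeff-outside p Pp ¬Pm

  coeff-monomial : ∀ {n} a (e : Vec ℕ n) → coeff ((a , e) ∷ []) e ≈ a
  coeff-monomial a e with ≡-dec ℕ._≟_ e e
  ... | yes _  = +-identityʳ a
  ... | no e≢e = ⊥-elim (e≢e refl)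

  coeff-monomial-≢ : ∀ {n} a {e m : Vec ℕ n} → e ≢ m → coeff ((a , e) ∷ []) m ≈ 0#
  coeff-monomial-≢ a {e} {m} e≢m = coeff-outside {P = _≢ m} ((a , e) ∷ []) (e≢m ∷ []) (λ m≢m → m≢m refl)

  mapTerms : ∀ {n} → Carrier → (Vec ℕ n → Vec ℕ n) → Poly n → Poly n
  mapTerms k h = map (λ t → (k * proj₁ t , h (proj₂ t)))

  coeff-mapTerms : ∀ {n} k {h : Vec ℕ n → Vec ℕ n} → Injective _≡_ _≡_ h → (p : Poly n) (m : Vec ℕ n) →
                   coeff (mapTerms k h p) (h m) ≈ k * coeff p m
  coeff-mapTerms k     inj []            m = ≈-sym (zeroʳ k)
  coeff-mapTerms k {h} inj ((a , e) ∷ p) m with ≡-dec ℕ._≟_ (h e) (h m) | ≡-dec ℕ._≟_ e m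
  ... | yes _     | yes _   = ≈-trans (+-cong ≈-refl (coeff-mapTerms k inj p m)) (≈-sym (distribˡ k a _))
  ... | no _      | no _    = coeff-mapTerms k inj p m
  ... | yes he≡hm | no e≢m  = ⊥-elim (e≢m (inj he≡hm))
  ... | no he≢hm  | yes e≡m = ⊥-elim (he≢hm (cong h e≡m))

  coeff-scaleP : ∀ {n} k (p : Poly n) m → coeff (scaleP k p) m ≈ k * coeff p m
  coeff-scaleP k = coeff-mapTerms k (λ eq → eq)

  coeff-sumP : ∀ {n} {a} {A : Set a} (h : A → Poly n) (xs : List A) m →
               coeff (sumP (map h xs)) m ≈ ∑[ x ← xs ] coeff (h x) m
  coeff-sumP h []       m = ≈-refl
  coeff-sumP h (x ∷ xs) m = ≈-trans (coeff-++ (h x) _ m) (+-cong ≈-refl (coeff-sumP h xs m))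

  -- Linear independence

  module Unitriangular {a} {A : Set a} {K M : Set} (key : A → K) (f : A → M → Carrier) (lead : A → M) (rank : A → ℕ)
    (lead-≉0 : ∀ t → ¬ (f t (lead t) ≈ 0#))
    (lower : ∀ t t′ → key t′ ≢ key t → rank t′ ≤ rank t → f t′ (lead t) ≈ 0#) where

    combination : List (Carrier × A) → M → Carrier
    combination xs m = ∑[ ct ← xs ] (proj₁ ct * f (proj₂ ct) m)

    _≤rank_ : Carrier × A → Carrier × A → Set
    y ≤rank t = rank (proj₂ y) ≤ rank (proj₂ t)

    Independent : List (Carrier × A) → Set (a Level.⊔ c Level.⊔ ℓ)
    Independent xs = Unique (map (key ∘ proj₂) xs) → (∀ m → combination xs m ≈ 0#) → All (λ ct → proj₁ ct ≈ 0#) xs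

    split-at-maximum : ∀ (x : Carrier × A) xs → ∃₂ λ ys t → ∃ λ zs →
      x ∷ xs ≡ ys ++ t ∷ zs × All (_≤rank t) (x ∷ xs)
    split-at-maximum x []        = [] , x , [] , refl , ℕP.≤-refl ∷ []
    split-at-maximum x (x′ ∷ xs) with split-at-maximum x′ xs
    ... | ys , t , zs , eq , ≤t with rank (proj₂ t) ℕP.≤? rank (proj₂ x)
    ...   | yes t≤x = [] , x , x′ ∷ xs , refl , ℕP.≤-refl ∷ All.map (λ y≤t → ℕP.≤-trans y≤t t≤x) ≤t
    ...   | no t≰x  = x ∷ ys , t , zs , cong (x ∷_) eq , ℕP.<⇒≤ (ℕP.≰⇒> t≰x) ∷ ≤t

    independent : ∀ N xs → length xs ≡ N → Independent xs
    independent _         []       _   _ _ = []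
    independent (ℕ.suc N) (x ∷ xs) len with split-at-maximum x xs
    ... | ys , t , zs , eq , ≤t =
      subst (λ l → All (_≤rank t) l → length l ≡ ℕ.suc N → Independent l) (sym eq) remove-maximum ≤t len
      where
      -- Only the term of maximal rank can contribute at its own leading exponent.
      remove-maximum : All (_≤rank t) (ys ++ t ∷ zs) →
                       length (ys ++ t ∷ zs) ≡ ℕ.suc N → Independent (ys ++ t ∷ zs)
      remove-maximum ≤t len uniq vanish = All-middle ys cₜ≈0 (independent N (ys ++ zs) len′ uniq′ vanish′)
        where
        len′ : length (ys ++ zs) ≡ N
        len′ = ℕP.suc-injective (trans (sym (length-middle ys t zs)) len)
        ≢t : All (λ y → key (proj₂ y) ≢ key (proj₂ t)) (ys ++ zs)
        ≢t = proj₁ (Unique-middle (key ∘ proj₂) ys t zs uniq)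
        uniq′ : Unique (map (key ∘ proj₂) (ys ++ zs))
        uniq′ = proj₂ (Unique-middle (key ∘ proj₂) ys t zs uniq)
        ≤t′ : All (_≤rank t) (ys ++ zs)
        ≤t′ = AllP.++⁺ (AllP.++⁻ˡ ys ≤t) (All.tail (AllP.++⁻ʳ ys ≤t))
        split : ∀ m → combination (ys ++ t ∷ zs) m ≈ proj₁ t * f (proj₂ t) m + combination (ys ++ zs) m
        split m = ∑-middle ys t zs (λ ct → proj₁ ct * f (proj₂ ct) m)
        others-vanish : combination (ys ++ zs) (lead (proj₂ t)) ≈ 0#
        others-vanish = ∑-≈0 (ys ++ zs) λ {y} y∈ →
          *-≈0ʳ (lower (proj₂ t) (proj₂ y) (All.lookup ≢t y∈) (All.lookup ≤t′ y∈))
        cₜ≈0 : proj₁ t ≈ 0#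
        cₜ≈0 = x*y≈0∧y≉0⇒x≈0 (≈-trans (≈-sym (+-≈0ʳ others-vanish))
                 (≈-trans (≈-sym (split (lead (proj₂ t)))) (vanish (lead (proj₂ t))))) (lead-≉0 (proj₂ t))
        vanish′ : ∀ m → combination (ys ++ zs) m ≈ 0#
        vanish′ m = ≈-trans (≈-sym (+-≈0ˡ (*-≈0ˡ cₜ≈0))) (≈-trans (≈-sym (split m)) (vanish m))

  ∏diff : ∀ {n} → List (Fin n × Fin n) → Poly n
  ∏diff zs = prodP (map (λ ab → var (proj₁ ab) -P var (proj₂ ab)) zs)

  mulVar : ∀ {n} → Carrier → Fin n → Poly n → Poly n
  mulVar k a = mapTerms k (basis a ⊕_)

  -- The coefficient that negP attaches to the y_b of y_a − y_b.
  -1′ : Carrier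
  -1′ = - 1# * 1#

  -1′*x≈-x : ∀ x → -1′ * x ≈ - x
  -1′*x≈-x x = ≈-trans (*-cong (*-identityʳ (- 1#)) ≈-refl) (RingProperties.-1*x≈-x ring x)

  -1′*-1′≈1 : -1′ * -1′ ≈ 1#
  -1′*-1′≈1 =
    ≈-trans (-1′*x≈-x -1′) (≈-trans (-‿cong (*-identityʳ (- 1#))) (RingProperties.-‿involutive ring 1#))

  coeff-∏diff-∷ : ∀ {n} a b (zs : List (Fin n × Fin n)) m →
    coeff (∏diff ((a , b) ∷ zs)) m ≈ coeff (mulVar 1# a (∏diff zs)) m + coeff (mulVar -1′ b (∏diff zs)) m
  coeff-∏diff-∷ a b zs m = ≈-trans (coeff-++ (mulVar 1# a q) _ m)
    (+-cong ≈-refl (≈-trans (coeff-++ (mulVar -1′ b q) [] m) (+-identityʳ _)))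
    where
    q : Poly _
    q = ∏diff zs

  All-∏diff-∷ : ∀ {n} {P : Vec ℕ n → Set} a b zs →
    All (λ t → P (basis a ⊕ proj₂ t)) (∏diff zs) → All (λ t → P (basis b ⊕ proj₂ t)) (∏diff zs) →
    All (P ∘ proj₂) (∏diff ((a , b) ∷ zs))
  All-∏diff-∷ a b zs Pa Pb = AllP.++⁺ (AllP.map⁺ Pa) (AllP.++⁺ (AllP.map⁺ Pb) [])

  ∏diff-⊑-leadExp : ∀ {n} (zs : List (Fin n × Fin n)) → Increasing zs → All (λ t → proj₂ t ⊑ leadExp zs) (∏diff zs)
  ∏diff-⊑-leadExp []             []          = (ℕP.≤-refl , λ _ → refl) ∷ []
  ∏diff-⊑-leadExp ((a , b) ∷ zs) (a<b ∷ inc) = All-∏diff-∷ a b zs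
    (All.map (⊑-basis-⊕-< a<b) (∏diff-⊑-leadExp zs inc)) (All.map (⊑-basis-⊕ b) (∏diff-⊑-leadExp zs inc))

  coeff-leadExp² : ∀ {n} (zs : List (Fin n × Fin n)) → Increasing zs →
                   coeff (∏diff zs) (leadExp zs) * coeff (∏diff zs) (leadExp zs) ≈ 1#
  coeff-leadExp² {n} []             []          = ≈-trans (*-cong c≈1 c≈1) (*-identityˡ 1#)
    where
    c≈1 : coeff (∏diff []) (replicate n 0) ≈ 1#
    c≈1 = coeff-monomial 1# (replicate n 0)
  coeff-leadExp² ((a , b) ∷ zs) (a<b ∷ inc) = begin
    γ′ * γ′                 ≈⟨ *-cong γ′≈-γ γ′≈-γ ⟩
    (-1′ * γ) * (-1′ * γ)   ≈⟨ *-CS.interchange -1′ γ -1′ γ ⟩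
    (-1′ * -1′) * (γ * γ)   ≈⟨ *-cong -1′*-1′≈1 (coeff-leadExp² zs inc) ⟩
    1# * 1#                 ≈⟨ *-identityˡ 1# ⟩
    1#                      ∎
    where
    q : Poly _
    q = ∏diff zs
    E : Vec ℕ _
    E = leadExp zs
    γ γ′ : Carrier
    γ = coeff q E
    γ′ = coeff (∏diff ((a , b) ∷ zs)) (basis b ⊕ E)
    a-terms-below : All (λ t → basis a ⊕ proj₂ t ≢ basis b ⊕ E) q
    a-terms-below = All.map (λ e⊑E eq → ℕP.<⇒≢ (weight-basis-⊕-< a<b (proj₁ e⊑E)) (cong weight eq))
                            (∏diff-⊑-leadExp zs inc)
    γ′≈-γ : γ′ ≈ -1′ * γ
    γ′≈-γ = ≈-trans (coeff-∏diff-∷ a b zs (basis b ⊕ E))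
      (≈-trans (+-≈0ˡ (coeff-outside {P = _≢ basis b ⊕ E} (mulVar 1# a q) (AllP.map⁺ a-terms-below)
                                      (λ ne → ne refl)))
               (coeff-mapTerms -1′ (⊕-cancelˡ (basis b)) q E))

  lead : ∀ {n} → Idx n → Vec ℕ n
  lead t = leadExp (columns t)

  coeff-G-lead-≉0 : ∀ {n} (t : Idx n) → ¬ (coeff (G t) (lead t) ≈ 0#)
  coeff-G-lead-≉0 t = x*x≈1⇒x≉0 (coeff-leadExp² (columns t) (columns-increasing t))

  coeff-G-below : ∀ {n} (t t′ : Idx n) → key t′ ≢ key t → weight (lead t′) ≤ weight (lead t) →
                  coeff (G t′) (lead t) ≈ 0#
  coeff-G-below t t′ t′≢t t′≤t = coeff-outside (G t′) (∏diff-⊑-leadExp (columns t′) (columns-increasing t′))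
    λ (t≤t′ , same-weight⇒≡) → t′≢t (sym (leadExp-determines-key t t′ (same-weight⇒≡ (ℕP.≤-antisym t≤t′ t′≤t))))

  coeff-lincomb : ∀ {n} (xs : List (Carrier × Idx n)) m →
                  coeff (lincomb xs) m ≈ ∑[ ct ← xs ] (proj₁ ct * coeff (G (proj₂ ct)) m)
  coeff-lincomb xs m = ≈-trans (coeff-sumP (λ ct → scaleP (proj₁ ct) (G (proj₂ ct))) xs m)
                               (∑-cong xs λ {ct} _ → coeff-scaleP (proj₁ ct) (G (proj₂ ct)) m)

  G-linearlyIndependent : ∀ n → LinIndepB' n
  G-linearlyIndependent n xs uniq lincomb≈0 =
    G-Unitriangular.independent (length xs) xs refl uniq λ m → ≈-trans (≈-sym (coeff-lincomb xs m)) (lincomb≈0 m)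
    where
    module G-Unitriangular =
      Unitriangular key (λ t → coeff (G t)) lead (weight ∘ lead) coeff-G-lead-≉0 coeff-G-below

  -- Membership in H

  pairWith : ∀ {n} → (Vec ℕ n → Carrier) → Poly n → Carrier
  pairWith D P = ∑[ t ← P ] (proj₁ t * D (proj₂ t))

  pairWith-expand : ∀ {n} (D : Vec ℕ n → Carrier) {E : List (Vec ℕ n)} → Unique E →
                    (P : Poly n) → All (λ t → proj₂ t ∈ E) P → pairWith D P ≈ ∑[ e ← E ] (coeff P e * D e)
  pairWith-expand D {E} _    []            []          = ≈-sym (∑-≈0 E λ {e} _ → zeroˡ (D e))
  pairWith-expand D {E} uniq ((a , e) ∷ P) (e∈E ∷ P⊆E) = begin
    a * D e + pairWith D P
      ≈⟨ +-cong head-term (pairWith-expand D uniq P P⊆E) ⟩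
    ∑[ e′ ← E ] (coeff ((a , e) ∷ []) e′ * D e′) + ∑[ e′ ← E ] (coeff P e′ * D e′)
      ≈⟨ ∑-distrib-+ E _ _ ⟨
    ∑[ e′ ← E ] (coeff ((a , e) ∷ []) e′ * D e′ + coeff P e′ * D e′)
      ≈⟨ ∑-cong E (λ {e′} _ → ≈-trans (≈-sym (distribʳ (D e′) _ _))
                                      (*-cong (≈-sym (coeff-++ ((a , e) ∷ []) P e′)) ≈-refl)) ⟩
    ∑[ e′ ← E ] (coeff ((a , e) ∷ P) e′ * D e′)
      ∎
    where
    head-term : a * D e ≈ ∑[ e′ ← E ] (coeff ((a , e) ∷ []) e′ * D e′)
    head-term = ≈-sym (≈-trans (∑-single E uniq e∈E λ e′ e′≢e → *-≈0ˡ (coeff-monomial-≢ a (≢-sym e′≢e)))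
                               (*-cong (coeff-monomial a e) ≈-refl))

  pairWith-cong : ∀ {n} (D : Vec ℕ n → Carrier) {P R : Poly n} → P ≈P R → pairWith D P ≈ pairWith D R
  pairWith-cong D {P} {R} P≈R = begin
    pairWith D P                 ≈⟨ pairWith-expand D uniq P (All.tabulate (∈-support ∘ ∈-++⁺ˡ ∘ exponent∈)) ⟩
    ∑[ e ← E ] (coeff P e * D e) ≈⟨ ∑-cong E (λ {e} _ → *-cong (P≈R e) ≈-refl) ⟩
    ∑[ e ← E ] (coeff R e * D e) ≈⟨ pairWith-expand D uniq R (All.tabulate (∈-support ∘ ∈-++⁺ʳ _ ∘ exponent∈)) ⟨
    pairWith D R                 ∎
    where
    E : List (Vec ℕ _)
    E = List.deduplicate (≡-dec ℕ._≟_) (map proj₂ P ++ map proj₂ R)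
    uniq : Unique E
    uniq = deduplicate-! (≡-dec ℕ._≟_) _
    ∈-support : ∀ {e} → e ∈ map proj₂ P ++ map proj₂ R → e ∈ E
    ∈-support = ∈-deduplicate⁺ (≡-dec ℕ._≟_)
    exponent∈ : ∀ {Q : Poly _} {t} → t ∈ Q → proj₂ t ∈ map proj₂ Q
    exponent∈ = ∈-map⁺ proj₂

  pairWith-sumP : ∀ {n} {a} {A : Set a} (D : Vec ℕ n → Carrier) (h : A → Poly n) (xs : List A) →
                  pairWith D (sumP (map h xs)) ≈ ∑[ x ← xs ] pairWith D (h x)
  pairWith-sumP D h []       = ≈-refl
  pairWith-sumP D h (x ∷ xs) = ≈-trans (∑-++ (h x) _ _) (+-cong ≈-refl (pairWith-sumP D h xs))

  pairWith-mapTerms : ∀ {n} (D : Vec ℕ n → Carrier) a (e : Vec ℕ n) (g : Poly n) →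
                      pairWith D (mapTerms a (e ⊕_) g) ≈ a * pairWith (λ f → D (e ⊕ f)) g
  pairWith-mapTerms D a e []            = ≈-sym (zeroʳ a)
  pairWith-mapTerms D a e ((b , f) ∷ g) =
    ≈-trans (+-cong (*-assoc a b _) (pairWith-mapTerms D a e g)) (≈-sym (distribˡ a _ _))

  pairWith-*P : ∀ {n} (D : Vec ℕ n → Carrier) (A g : Poly n) →
                (∀ e → pairWith (λ f → D (e ⊕ f)) g ≈ 0#) → pairWith D (A *P g) ≈ 0#
  pairWith-*P D []            g _      = ≈-refl
  pairWith-*P D ((a , e) ∷ A) g g-kill = ≈-trans (∑-++ (mapTerms a (e ⊕_) g) _ _)
    (≈-trans (+-≈0ʳ (pairWith-*P D A g g-kill)) (≈-trans (pairWith-mapTerms D a e g) (*-≈0ʳ (g-kill e))))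

  pairWith-InI : ∀ {n} (D : Vec ℕ n → Carrier) → (∀ j e → pairWith (λ f → D (e ⊕ f)) (gen j) ≈ 0#) →
                 ∀ {P} → InI P → pairWith D P ≈ 0#
  pairWith-InI {n} D gen-kill {P} (A , P≈∑Agen) = begin
    pairWith D P                                   ≈⟨ pairWith-cong D {P} {sumP (map Agen js)} P≈∑Agen ⟩
    pairWith D (sumP (map Agen js))                ≈⟨ pairWith-sumP D Agen js ⟩
    ∑[ j ← js ] pairWith D (A j *P gen j)          ≈⟨ ∑-≈0 js (λ {j} _ → pairWith-*P D (A j) (gen j) (gen-kill j)) ⟩
    0#                                             ∎
    where
    js : List (Fin (ℕ.suc n))
    js = allFin (ℕ.suc n)
    Agen : Fin (ℕ.suc n) → Poly n
    Agen j = A j *P gen j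

  ⟨,⟩≈pairWith : ∀ {n} (P Q : Poly n) → ⟨ P , Q ⟩ ≈ pairWith (λ e → coeff (∂^ e Q) (replicate n 0)) P
  ⟨,⟩≈pairWith []            Q = ≈-refl
  ⟨,⟩≈pairWith {n} ((a , e) ∷ P) Q = ≈-trans (coeff-++ (scaleP a (∂^ e Q)) _ (replicate n 0))
    (+-cong (coeff-scaleP a (∂^ e Q) _) (⟨,⟩≈pairWith P Q))

  rising : ℕ → ℕ → Carrier
  rising x ℕ.zero    = 1#
  rising x (ℕ.suc k) = rising (ℕ.suc x) k * fromℕ (ℕ.suc x)

  coeff-dTerm : ∀ {n} (i : Fin n) a (e m : Vec ℕ n) →
                coeff (dTerm i (a , e)) m ≈ coeff ((a , e) ∷ []) (basis i ⊕ m) * fromℕ (ℕ.suc (lookup m i))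
  coeff-dTerm i a e m with lookup e i in eᵢ
  ... | ℕ.zero = ≈-sym (*-≈0ˡ (coeff-monomial-≢ a {e} {basis i ⊕ m}
                                λ { refl → ℕP.0≢1+n (trans (sym eᵢ) (lookup-basis-⊕ i m)) }))
  ... | ℕ.suc k with ≡-dec ℕ._≟_ e (basis i ⊕ m)
  ...   | yes refl = begin
    coeff ((a * fromℕ (ℕ.suc k) , (basis i ⊕ m) [ i ]≔ k) ∷ []) m
      ≈⟨ reflexive (cong (λ v → coeff ((a * fromℕ (ℕ.suc k) , v) ∷ []) m) lowered≡m) ⟩
    coeff ((a * fromℕ (ℕ.suc k) , m) ∷ []) m
      ≈⟨ coeff-monomial _ m ⟩
    a * fromℕ (ℕ.suc k)
      ≈⟨ *-cong (≈-sym (+-identityʳ a)) (reflexive (cong (fromℕ ∘ ℕ.suc) k≡mᵢ)) ⟩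
    (a + 0#) * fromℕ (ℕ.suc (lookup m i))
      ∎
    where
    k≡mᵢ : k ≡ lookup m i
    k≡mᵢ = ℕP.suc-injective (trans (sym eᵢ) (lookup-basis-⊕ i m))
    lowered≡m : (basis i ⊕ m) [ i ]≔ k ≡ m
    lowered≡m = ⊕-cancelˡ (basis i) (sym (basis-⊕-split (basis i ⊕ m) i eᵢ))
  ...   | no e≢ =
    ≈-trans (coeff-monomial-≢ _ {e [ i ]≔ k} {m} λ { refl → e≢ (basis-⊕-split e i eᵢ) }) (≈-sym (zeroˡ _))

  coeff-∂ : ∀ {n} (i : Fin n) (p : Poly n) m → coeff (∂ i p) m ≈ coeff p (basis i ⊕ m) * fromℕ (ℕ.suc (lookup m i))
  coeff-∂ i []            m = ≈-sym (zeroˡ _)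
  coeff-∂ i ((a , e) ∷ p) m = begin
    coeff (dTerm i (a , e) ++ ∂ i p) m              ≈⟨ coeff-++ (dTerm i (a , e)) (∂ i p) m ⟩
    coeff (dTerm i (a , e)) m + coeff (∂ i p) m     ≈⟨ +-cong (coeff-dTerm i a e m) (coeff-∂ i p m) ⟩
    coeff ((a , e) ∷ []) m′ * d + coeff p m′ * d    ≈⟨ distribʳ d _ _ ⟨
    (coeff ((a , e) ∷ []) m′ + coeff p m′) * d      ≈⟨ *-cong (coeff-++ ((a , e) ∷ []) p m′) ≈-refl ⟨
    coeff ((a , e) ∷ p) m′ * d                      ∎
    where
    m′ : Vec ℕ _
    m′ = basis i ⊕ m
    d : Carrier
    d = fromℕ (ℕ.suc (lookup m i))

  coeff-iter-∂ : ∀ {n} (i : Fin n) k (p : Poly n) m →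
                 coeff (iter k (∂ i) p) m ≈ coeff p (m [ i ]≔ (lookup m i ℕ.+ k)) * rising (lookup m i) k
  coeff-iter-∂ i ℕ.zero    p m = ≈-trans (reflexive (cong (coeff p) (sym m[i]≔mᵢ))) (≈-sym (*-identityʳ _))
    where
    m[i]≔mᵢ : m [ i ]≔ (lookup m i ℕ.+ 0) ≡ m
    m[i]≔mᵢ = trans (cong (m [ i ]≔_) (ℕP.+-identityʳ _)) (VecP.[]≔-lookup m i)
  coeff-iter-∂ i (ℕ.suc k) p m = begin
    coeff (∂ i (iter k (∂ i) p)) m
      ≈⟨ coeff-∂ i (iter k (∂ i) p) m ⟩
    coeff (iter k (∂ i) p) (basis i ⊕ m) * d
      ≈⟨ *-cong (coeff-iter-∂ i k p (basis i ⊕ m)) ≈-refl ⟩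
    (coeff p ((basis i ⊕ m) [ i ]≔ (lookup (basis i ⊕ m) i ℕ.+ k)) * rising (lookup (basis i ⊕ m) i) k) * d
      ≈⟨ *-cong (*-cong (reflexive (cong (coeff p) (update-basis-⊕ m i k)))
                        (reflexive (cong (λ x → rising x k) (lookup-basis-⊕ i m)))) ≈-refl ⟩
    (coeff p (m [ i ]≔ (lookup m i ℕ.+ ℕ.suc k)) * rising (ℕ.suc (lookup m i)) k) * d
      ≈⟨ *-assoc _ _ _ ⟩
    coeff p (m [ i ]≔ (lookup m i ℕ.+ ℕ.suc k)) * rising (lookup m i) (ℕ.suc k)
      ∎
    where
    d : Carrier
    d = fromℕ (ℕ.suc (lookup m i))

  raise : ∀ {n} → Vec ℕ n → List (Fin n) → Vec ℕ n → Vec ℕ n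
  raise f []       m = m
  raise f (i ∷ is) m = raise f is (m [ i ]≔ (lookup m i ℕ.+ lookup f i))

  risingProduct : ∀ {n} → Vec ℕ n → List (Fin n) → Vec ℕ n → Carrier
  risingProduct f []       m = 1#
  risingProduct f (i ∷ is) m =
    risingProduct f is (m [ i ]≔ (lookup m i ℕ.+ lookup f i)) * rising (lookup m i) (lookup f i)

  coeff-∂s : ∀ {n} (f : Vec ℕ n) is (p : Poly n) m →
             coeff (foldr (λ i r → iter (lookup f i) (∂ i) r) p is) m ≈ coeff p (raise f is m) * risingProduct f is m
  coeff-∂s f []       p m = ≈-sym (*-identityʳ _)
  coeff-∂s f (i ∷ is) p m =
    ≈-trans (coeff-iter-∂ i (lookup f i) _ m) (≈-trans (*-cong (coeff-∂s f is p _) ≈-refl) (*-assoc _ _ _))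

  lookup-raise-∉ : ∀ {n} f (is : List (Fin n)) m {j} → j ∉ is → lookup (raise f is m) j ≡ lookup m j
  lookup-raise-∉ f []       m _   = refl
  lookup-raise-∉ f (i ∷ is) m j∉ =
    trans (lookup-raise-∉ f is _ (j∉ ∘ there)) (VecP.lookup∘update′ (j∉ ∘ here) m _)

  lookup-raise-∈ : ∀ {n} f (is : List (Fin n)) m {j} → Unique is → j ∈ is →
                   lookup (raise f is m) j ≡ lookup m j ℕ.+ lookup f j
  lookup-raise-∈ f (i ∷ is) m (i∉is ∷ _) (here refl) =
    trans (lookup-raise-∉ f is _ λ i∈is → All.lookup i∉is i∈is refl) (VecP.lookup∘update i m _)
  lookup-raise-∈ f (i ∷ is) m (i∉is ∷ uniq) (there j∈is) =
    trans (lookup-raise-∈ f is _ uniq j∈is)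
          (cong (ℕ._+ lookup f _) (VecP.lookup∘update′ (λ { refl → All.lookup i∉is j∈is refl }) m _))

  raise-allFin : ∀ {n} (f : Vec ℕ n) → raise f (allFin n) (replicate n 0) ≡ f
  raise-allFin {n} f = pointwise⇒≡ λ j →
    trans (lookup-raise-∈ f (allFin n) _ (allFin⁺ n) (∈-allFin j))
          (cong (ℕ._+ lookup f j) (VecP.lookup-replicate j 0))

  risingProduct-squarefree : ∀ {n} (f : Vec ℕ n) is m → Unique is → (∀ {j} → j ∈ is → lookup m j ≡ 0) →
                             Squarefree f → risingProduct f is m ≈ 1#
  risingProduct-squarefree f []       m _              _     _  = ≈-refl
  risingProduct-squarefree f (i ∷ is) m (i∉is ∷ uniq) m≡0 sq =
    ≈-trans (*-cong (risingProduct-squarefree f is _ uniq m′≡0 sq) rising0≈1) (*-identityˡ 1#)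
    where
    m′≡0 : ∀ {j} → j ∈ is → lookup (m [ i ]≔ (lookup m i ℕ.+ lookup f i)) j ≡ 0
    m′≡0 j∈is = trans (VecP.lookup∘update′ (λ { refl → All.lookup i∉is j∈is refl }) m _) (m≡0 (there j∈is))
    rising0≈1 : rising (lookup m i) (lookup f i) ≈ 1#
    rising0≈1 rewrite m≡0 (here refl) with lookup f i | sq i
    ... | ℕ.zero           | _        = ≈-refl
    ... | ℕ.suc ℕ.zero     | _        = ≈-trans (*-identityˡ _) (+-identityʳ 1#)
    ... | ℕ.suc (ℕ.suc _) | s≤s ()

  coeff-∂^-squarefree : ∀ {n} {Q : Poly n} → All (Squarefree ∘ proj₂) Q →
                        ∀ v → coeff (∂^ v Q) (replicate n 0) ≈ coeff Q v
  coeff-∂^-squarefree {n} {Q} sqQ v with FinP.all? (λ j → lookup v j ℕP.≤? 1)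
  ... | yes sq = begin
    coeff (∂^ v Q) (replicate n 0)                             ≈⟨ coeff-∂s v (allFin n) Q _ ⟩
    coeff Q (raise v (allFin n) _) * risingProduct v (allFin n) _
      ≈⟨ *-cong (reflexive (cong (coeff Q) (raise-allFin v)))
                (risingProduct-squarefree v (allFin n) _ (allFin⁺ n) (λ {j} _ → VecP.lookup-replicate j 0) sq) ⟩
    coeff Q v * 1#                                             ≈⟨ *-identityʳ _ ⟩
    coeff Q v                                                  ∎
  ... | no ¬sq = ≈-trans (coeff-∂s v (allFin n) Q _)
    (≈-trans (*-≈0ˡ (≈-trans (reflexive (cong (coeff Q) (raise-allFin v))) Qᵥ≈0)) (≈-sym Qᵥ≈0))
    where
    Qᵥ≈0 : coeff Q v ≈ 0#
    Qᵥ≈0 = coeff-outside Q sqQ ¬sq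

  -- For squarefree q this says (∑ᵢ ∂ᵢ) q = 0.
  Balanced : ∀ {n} → Poly n → Set ℓ
  Balanced {n} q = ∀ e → ∑[ i ← allFin n ] coeff q (e ⊕ basis i) ≈ 0#

  squarefree-balanced⇒InH : ∀ {n} {Q : Poly n} → All (Squarefree ∘ proj₂) Q → Balanced Q → InH Q
  squarefree-balanced⇒InH {n} {Q} sqQ balQ P P∈I = begin
    ⟨ P , Q ⟩                                        ≈⟨ ⟨,⟩≈pairWith P Q ⟩
    pairWith (λ e → coeff (∂^ e Q) (replicate n 0)) P
      ≈⟨ ∑-cong P (λ {t} _ → *-cong ≈-refl (coeff-∂^-squarefree sqQ (proj₂ t))) ⟩
    pairWith (coeff Q) P                             ≈⟨ pairWith-InI (coeff Q) gen-kill {P} P∈I ⟩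
    0#                                               ∎
    where
    gen-kill : ∀ j e → pairWith (λ f → coeff Q (e ⊕ f)) (gen j) ≈ 0#
    gen-kill Fin.zero    e = ≈-trans (pairWith-sumP _ var (allFin n))
      (≈-trans (∑-cong (allFin n) λ _ → ≈-trans (+-identityʳ _) (*-identityˡ _)) (balQ e))
    gen-kill (Fin.suc i) e = ≈-trans (+-identityʳ _) (*-≈0ʳ (coeff-outside Q sqQ (¬Squarefree-⊕-basis² e i)))

  ∑-coeff-mulVar-fresh : ∀ {n} k (x : Fin n) (q : Poly n) e → lookup e x ≡ 0 →
                         ∑[ i ← allFin n ] coeff (mulVar k x q) (e ⊕ basis i) ≈ k * coeff q e
  ∑-coeff-mulVar-fresh {n} k x q e eₓ≡0 = ≈-trans (∑-single (allFin n) (allFin⁺ n) (∈-allFin x) off-x) at-x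
    where
    off-x : ∀ i → i ≢ x → coeff (mulVar k x q) (e ⊕ basis i) ≈ 0#
    off-x i i≢x = coeff-outside {P = _≢ e ⊕ basis i} (mulVar k x q)
      (AllP.map⁺ (All.tabulate λ {t} _ → basis-⊕-≢-⊕-basis (proj₂ t) e eₓ≡0 i≢x)) (λ ne → ne refl)
    at-x : coeff (mulVar k x q) (e ⊕ basis x) ≈ k * coeff q e
    at-x = ≈-trans (reflexive (cong (coeff (mulVar k x q)) (⊕-comm e (basis x))))
                   (coeff-mapTerms k (⊕-cancelˡ (basis x)) q e)

  ∑-coeff-mulVar-balanced : ∀ {n} k (x : Fin n) {q : Poly n} → Balanced q → ∀ e {s} → lookup e x ≡ ℕ.suc s →
                            ∑[ i ← allFin n ] coeff (mulVar k x q) (e ⊕ basis i) ≈ 0#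
  ∑-coeff-mulVar-balanced {n} k x {q} balq e eₓ≡1+s with basis-⊕-split e x eₓ≡1+s
  ... | e≡ = begin
    ∑[ i ← allFin n ] coeff (mulVar k x q) (e ⊕ basis i)      ≈⟨ ∑-cong (allFin n) (λ {i} _ → shift i) ⟩
    ∑[ i ← allFin n ] (k * coeff q (e′ ⊕ basis i))           ≈⟨ *-distribˡ-∑ (allFin n) k _ ⟨
    k * ∑[ i ← allFin n ] coeff q (e′ ⊕ basis i)             ≈⟨ *-≈0ʳ (balq e′) ⟩
    0#                                                       ∎
    where
    e′ : Vec ℕ n
    e′ = e [ x ]≔ _
    shift : ∀ i → coeff (mulVar k x q) (e ⊕ basis i) ≈ k * coeff q (e′ ⊕ basis i)
    shift i = ≈-trans (reflexive (cong (λ v → coeff (mulVar k x q) (v ⊕ basis i)) e≡))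
      (≈-trans (reflexive (cong (coeff (mulVar k x q)) (⊕-assoc (basis x) e′ (basis i))))
               (coeff-mapTerms k (⊕-cancelˡ (basis x)) q (e′ ⊕ basis i)))

  ∏diff-monomials : ∀ {n} (zs : List (Fin n × Fin n)) → PairwiseDisjoint zs →
                    All (λ t → Squarefree (proj₂ t) × SupportedIn zs (proj₂ t)) (∏diff zs)
  ∏diff-monomials {n} [] _ = ((λ j → subst (_≤ 1) (sym (VecP.lookup-replicate j 0)) z≤n) ,
                             (λ j _ → VecP.lookup-replicate j 0)) ∷ []
  ∏diff-monomials ((a , b) ∷ zs) (a∉zs , b∉zs , disjoint) = All-∏diff-∷ a b zs
    (All.map (step a∉zs (proj₁ ∘ All.head)) (∏diff-monomials zs disjoint))
    (All.map (step b∉zs (proj₂ ∘ All.head)) (∏diff-monomials zs disjoint))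
    where
    step : ∀ {x e} → Absent x zs → (∀ {j} → Absent j ((a , b) ∷ zs) → j ≢ x) →
           Squarefree e × SupportedIn zs e → Squarefree (basis x ⊕ e) × SupportedIn ((a , b) ∷ zs) (basis x ⊕ e)
    step {x} x∉zs j∉⇒j≢x (sq , supp) = Squarefree-basis-⊕ (supp x x∉zs) sq , SupportedIn-basis-⊕ j∉⇒j≢x supp

  ∏diff-balanced : ∀ {n} (zs : List (Fin n × Fin n)) → PairwiseDisjoint zs → Balanced (∏diff zs)
  ∏diff-balanced {n} []             _ e =
    ∑-≈0 (allFin n) λ {i} _ → coeff-monomial-≢ 1# (≢-sym (⊕-basis-≢-0 e i))
  ∏diff-balanced {n} ((a , b) ∷ zs) (a∉zs , b∉zs , disjoint) e = begin
    ∑[ i ← allFin n ] coeff (∏diff ((a , b) ∷ zs)) (e ⊕ basis i) ≈⟨ ∑-cong (allFin n) (λ {i} _ → coeff-∏diff-∷ a b zs _) ⟩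
    ∑[ i ← allFin n ] (coeff (mulVar 1# a q) (e ⊕ basis i) + coeff (mulVar -1′ b q) (e ⊕ basis i))
                                                                  ≈⟨ ∑-distrib-+ (allFin n) _ _ ⟩
    Σa + Σb                                                       ≈⟨ by-cases (lookup e a) (lookup e b) refl refl ⟩
    0#                                                            ∎
    where
    q : Poly n
    q = ∏diff zs
    Σa Σb : Carrier
    Σa = ∑[ i ← allFin n ] coeff (mulVar 1# a q) (e ⊕ basis i)
    Σb = ∑[ i ← allFin n ] coeff (mulVar -1′ b q) (e ⊕ basis i)
    balq : Balanced q
    balq = ∏diff-balanced zs disjoint
    unsupported : ∀ {x s} → Absent x zs → lookup e x ≡ ℕ.suc s → coeff q e ≈ 0#
    unsupported x∉zs eₓ≡1+s = coeff-outside {P = SupportedIn zs} q (All.map proj₂ (∏diff-monomials zs disjoint))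
      λ supp → ℕP.0≢1+n (trans (sym (supp _ x∉zs)) eₓ≡1+s)
    by-cases : ∀ α β → lookup e a ≡ α → lookup e b ≡ β → Σa + Σb ≈ 0#
    by-cases ℕ.zero ℕ.zero eₐ e_b = begin
      Σa + Σb                         ≈⟨ +-cong (∑-coeff-mulVar-fresh 1# a q e eₐ) (∑-coeff-mulVar-fresh -1′ b q e e_b) ⟩
      1# * coeff q e + -1′ * coeff q e ≈⟨ distribʳ (coeff q e) 1# -1′ ⟨
      (1# + -1′) * coeff q e           ≈⟨ *-≈0ˡ (≈-trans (+-cong ≈-refl (*-identityʳ (- 1#))) (-‿inverseʳ 1#)) ⟩
      0#                               ∎
    by-cases ℕ.zero (ℕ.suc _) eₐ e_b = ≈-trans
      (+-cong (≈-trans (∑-coeff-mulVar-fresh 1# a q e eₐ) (*-≈0ʳ (unsupported b∉zs e_b)))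
              (∑-coeff-mulVar-balanced -1′ b {q} balq e e_b)) (+-identityʳ 0#)
    by-cases (ℕ.suc _) ℕ.zero eₐ e_b = ≈-trans
      (+-cong (∑-coeff-mulVar-balanced 1# a {q} balq e eₐ)
              (≈-trans (∑-coeff-mulVar-fresh -1′ b q e e_b) (*-≈0ʳ (unsupported a∉zs eₐ)))) (+-identityʳ 0#)
    by-cases (ℕ.suc _) (ℕ.suc _) eₐ e_b = ≈-trans
      (+-cong (∑-coeff-mulVar-balanced 1# a {q} balq e eₐ) (∑-coeff-mulVar-balanced -1′ b {q} balq e e_b))
      (+-identityʳ 0#)

  G-InH : ∀ {n} (t : Idx n) → InH (G t)
  G-InH t = squarefree-balanced⇒InH (All.map proj₁ (∏diff-monomials (columns t) (columns-disjoint t)))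
                                    (∏diff-balanced (columns t) (columns-disjoint t))

theorem3p6 : ∀ {c ℓ} (F : Field c ℓ) → WithField.CharZero F → (n : ℕ) →
    ((t : Idx n) → WithField.InH F (WithField₂.G F t)) × WithField₂.LinIndepB' F n
theorem3p6 F _ n = G-InH F , G-linearlyIndependent F n
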